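{- Let $T(a,u,x)$ be the generating function of bi-coloured Dyck paths in which every step starting at height $0$ or $1$ is red, where $u$ marks half-length, $a$ marks the number of multicoloured peaks, and $x$ marks the number of vertices of the path at height $1$. Then \[T(a,u,x)=\frac{4+2xu-2xau-x+x\sqrt{1-12u+4u^{2}-4au+4a^{2}u^{2}-8au^{2}}}{4-2xu-2xau-x+x\sqrt{1-12u+4u^{2}-4au+4a^{2}u^{2}-8au^{2}}},\] where the square root is the formal power series in $u$ with constant term $1$.
   Context: A bi-coloured Dyck path is a Dyck path (up and down unit steps, starting and ending at height $0$, never below height $0$) in which each step is coloured red or blue. A multicoloured peak is an up-step immediately followed by a down-step of the opposite colour. -}

module Defs where

open import Data.Nat as ℕ using (ℕ; zero; suc)
open import Data.Integer using (ℤ; +_; _+_; _*_; _-_; _^_; 0ℤ; 1ℤ)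
open import Data.Bool using (Bool; true; false; _∧_; if_then_else_)
open import Data.List using (List; []; _∷_; map; concatMap; filter; foldr)
open import Data.Product using (_×_; _,_)
open import Relation.Nullary.Decidable using (Dec)
open import Relation.Binary.PropositionalEquality using (_≡_)
open import Data.Bool.Properties using () renaming (_≟_ to _≟B_)

data Dir : Set where
  up down : Dir

data Colour : Set where
  red blue : Colour

Step : Set
Step = Dir × Colour

words : ℕ → List (List Step)
words zero    = [] ∷ []
words (suc n) = concatMap (λ w → ((up , red) ∷ w) ∷ ((up , blue) ∷ w) ∷
                                  ((down , red) ∷ w) ∷ ((down , blue) ∷ w) ∷ []) (words n)

dyckFrom : ℕ → List Step → Bool
dyckFrom zero    []                 = true
dyckFrom (suc h) []                 = false
dyckFrom h       ((up , _) ∷ s)     = dyckFrom (suc h) s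
dyckFrom zero    ((down , _) ∷ s)   = false
dyckFrom (suc h) ((down , _) ∷ s)   = dyckFrom h s

isDyck : List Step → Bool
isDyck = dyckFrom 0

isRed : Colour → Bool
isRed red  = true
isRed blue = false

lowRedFrom : ℕ → List Step → Bool
lowRedFrom h []                 = true
lowRedFrom h ((d , c) ∷ s) = ok h c ∧ lowRedFrom (next h d) s
  where
  ok : ℕ → Colour → Bool
  ok zero          c = isRed c
  ok (suc zero)    c = isRed c
  ok (suc (suc _)) c = true
  next : ℕ → Dir → ℕ
  next h up        = suc h
  next h down      = h ℕ.∸ 1

valid : List Step → Bool
valid w = isDyck w ∧ lowRedFrom 0 w

differentColour : Colour → Colour → Bool
differentColour red  blue = true
differentColour blue red  = true
differentColour _    _    = false

peaks : List Step → ℕ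
peaks ((up , c) ∷ (down , c') ∷ s) =
  (if differentColour c c' then 1 else 0) ℕ.+ peaks ((down , c') ∷ s)
peaks (_ ∷ s) = peaks s
peaks []      = 0

heightOneFrom : ℕ → List Step → ℕ
heightOneFrom h s = here h ℕ.+ rest h s
  where
  here : ℕ → ℕ
  here (suc zero) = 1
  here _          = 0
  rest : ℕ → List Step → ℕ
  rest h []                 = 0
  rest h ((up , _) ∷ s)     = heightOneFrom (suc h) s
  rest h ((down , _) ∷ s)   = heightOneFrom (h ℕ.∸ 1) s

heightOneVertices : List Step → ℕ
heightOneVertices = heightOneFrom 0

-- Formal power series in u with integer coefficients, as sequences.
-- The variables a and x are evaluated at arbitrary integers.

Series : Set
Series = ℕ → ℤ

T : ℤ → ℤ → Series
T a x n = foldr _+_ 0ℤ (map (λ w → (a ^ peaks w) * (x ^ heightOneVertices w))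
                   (filter (λ w → valid w ≟B true) (words (2 ℕ.* n))))

sumUpTo : ℕ → (ℕ → ℤ) → ℤ
sumUpTo zero    f = f 0
sumUpTo (suc n) f = sumUpTo n f + f (suc n)

_⊛_ : Series → Series → Series
(f ⊛ g) n = sumUpTo n (λ k → f k * g (n ℕ.∸ k))

poly3 : ℤ → ℤ → ℤ → Series
poly3 c0 c1 c2 zero                = c0
poly3 c0 c1 c2 (suc zero)          = c1
poly3 c0 c1 c2 (suc (suc zero))    = c2
poly3 c0 c1 c2 (suc (suc (suc _))) = 0ℤ

_⊕_ : Series → Series → Series
(f ⊕ g) n = f n + g n

_·_ : ℤ → Series → Series
(c · f) n = c * f n

radicand : ℤ → Series
radicand a = poly3 1ℤ (- (+ 12) - (+ 4) * a)
                      ((+ 4) + (+ 4) * a * a - (+ 8) * a)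
  where open Data.Integer using (-_)

numer : ℤ → ℤ → Series → Series
numer a x S = poly3 ((+ 4) - x) ((+ 2) * x - (+ 2) * x * a) 0ℤ ⊕ (x · S)

denom : ℤ → ℤ → Series → Series
denom a x S = poly3 ((+ 4) - x) (- ((+ 2) * x) - (+ 2) * x * a) 0ℤ ⊕ (x · S)
  where open Data.Integer using (-_)

module Submission where

-- Count paths by length, in a variable t with u = t².  Cutting a path after its first step and at
-- its first return to height 1 gives T = 1 + t D₁ and D₁ = x t (T + Fʳ D₁), where D₁ counts suffixes
-- from height 1 and Fʳ counts unrestricted paths from height 1 to their first visit to height 0,
-- preceded by a red up-step.  Hence T (1 − x t Fʳ − x t²) = 1 − x t Fʳ.  The same first-passage
-- decomposition gives F = 2t (F + (a − 1) t) F + 2t for the series F without preceding up-step,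
-- and Fʳ = F + (a − 1) t.  The quadratic equation for F makes (1 + (2 − 2a) t² − 4 t F)² the
-- radicand at u = t², so this series is S(t²) by uniqueness of square roots with constant term 1;
-- substituting it turns the identity for T into the stated one, multiplied by 4.

open import Defs
open import Data.Nat as ℕ using (ℕ; zero; suc; parity; _∸_; _≤_; _<_; z≤n; s≤s)
import Data.Nat.Properties as ℕ
open import Data.Nat.Induction using (<-rec)
open import Data.Parity.Base using (_⁻¹)
open import Data.Parity.Properties using (suc-homo-⁻¹; ⁻¹-selfInverse)
open import Data.Integer using (ℤ; +_; -_; _+_; _*_; _-_; _^_; 0ℤ; 1ℤ)
open import Data.Integer.Properties
open import Data.Integer.Tactic.RingSolver using (solve-∀)
open import Algebra.Bundles using (AbelianGroup)
import Algebra.Properties.Group as GroupProperties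
open import Data.Bool using (Bool; true; false; _∧_; if_then_else_)
open import Data.Bool.Properties using (∧-zeroʳ) renaming (_≟_ to _≟B_)
open import Data.List using (List; []; _∷_; map; concatMap; filter; foldr; _++_)
open import Data.List.Properties using (map-++)
open import Data.Maybe using (Maybe; just; nothing)
open import Data.Product using (∃; _,_)
open import Data.Sum using (_⊎_; inj₁; inj₂)
open import Function using (_∘_)
open import Relation.Binary.PropositionalEquality

-- Formal power series

sumUpTo-cong≤ : ∀ n {f g : ℕ → ℤ} → (∀ k → k ≤ n → f k ≡ g k) → sumUpTo n f ≡ sumUpTo n g
sumUpTo-cong≤ zero    f≡g = f≡g 0 z≤n
sumUpTo-cong≤ (suc n) f≡g =
  cong₂ _+_ (sumUpTo-cong≤ n (λ k k≤n → f≡g k (ℕ.m≤n⇒m≤1+n k≤n))) (f≡g (suc n) ℕ.≤-refl)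

sumUpTo-cong : ∀ n {f g : ℕ → ℤ} → f ≗ g → sumUpTo n f ≡ sumUpTo n g
sumUpTo-cong n f≗g = sumUpTo-cong≤ n (λ k _ → f≗g k)

sumUpTo-+ : ∀ n (f g : ℕ → ℤ) → sumUpTo n (λ k → f k + g k) ≡ sumUpTo n f + sumUpTo n g
sumUpTo-+ zero    f g = refl
sumUpTo-+ (suc n) f g rewrite sumUpTo-+ n f g = +-interchange (sumUpTo n f) (sumUpTo n g) (f (suc n)) (g (suc n))
  where
  +-interchange : ∀ a b c d → a + b + (c + d) ≡ a + c + (b + d)
  +-interchange = solve-∀

sumUpTo-*ˡ : ∀ n c (f : ℕ → ℤ) → sumUpTo n (λ k → c * f k) ≡ c * sumUpTo n f
sumUpTo-*ˡ zero    c f = refl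
sumUpTo-*ˡ (suc n) c f rewrite sumUpTo-*ˡ n c f = sym (*-distribˡ-+ c (sumUpTo n f) (f (suc n)))

sumUpTo-zero : ∀ n → sumUpTo n (λ _ → 0ℤ) ≡ 0ℤ
sumUpTo-zero zero    = refl
sumUpTo-zero (suc n) rewrite sumUpTo-zero n = refl

sumUpTo-suc : ∀ n (f : ℕ → ℤ) → sumUpTo (suc n) f ≡ f 0 + sumUpTo n (f ∘ suc)
sumUpTo-suc zero    f = refl
sumUpTo-suc (suc n) f rewrite sumUpTo-suc n f = +-assoc (f 0) _ _

sumUpTo-reverse : ∀ n (f : ℕ → ℤ) → sumUpTo n f ≡ sumUpTo n (λ k → f (n ∸ k))
sumUpTo-reverse zero    f = refl
sumUpTo-reverse (suc n) f = begin
  sumUpTo n f + f (suc n)                    ≡⟨ cong (_+ f (suc n)) (sumUpTo-reverse n f) ⟩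
  sumUpTo n (λ k → f (n ∸ k)) + f (suc n)    ≡⟨ +-comm _ (f (suc n)) ⟩
  f (suc n) + sumUpTo n (λ k → f (n ∸ k))    ≡⟨ sym (sumUpTo-suc n (λ k → f (suc n ∸ k))) ⟩
  sumUpTo (suc n) (λ k → f (suc n ∸ k))      ∎
  where open ≡-Reasoning

one : Series
one zero    = 1ℤ
one (suc n) = 0ℤ

shift : Series → Series
shift f zero    = 0ℤ
shift f (suc n) = f n

tail : Series → Series
tail f n = f (suc n)

shift-cong : ∀ {f g} → f ≗ g → shift f ≗ shift g
shift-cong f≗g zero    = refl
shift-cong f≗g (suc n) = f≗g n

⊛-suc : ∀ f g n → (f ⊛ g) (suc n) ≡ f 0 * g (suc n) + (tail f ⊛ g) n
⊛-suc f g n = sumUpTo-suc n (λ k → f k * g (suc n ∸ k))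

⊛-split : ∀ f g → f ⊛ g ≗ (f 0 · g) ⊕ shift (tail f ⊛ g)
⊛-split f g zero    = sym (+-identityʳ (f 0 * g 0))
⊛-split f g (suc n) = ⊛-suc f g n

⊛-cong≤ : ∀ n {f f′ g g′} → (∀ k → k ≤ n → f k ≡ f′ k) → (∀ k → k ≤ n → g k ≡ g′ k) →
          (f ⊛ g) n ≡ (f′ ⊛ g′) n
⊛-cong≤ n f≡ g≡ = sumUpTo-cong≤ n (λ k k≤n → cong₂ _*_ (f≡ k k≤n) (g≡ (n ∸ k) (ℕ.m∸n≤m n k)))

⊛-cong : ∀ {f f′ g g′} → f ≗ f′ → g ≗ g′ → f ⊛ g ≗ f′ ⊛ g′
⊛-cong f≗ g≗ n = ⊛-cong≤ n (λ k _ → f≗ k) (λ k _ → g≗ k)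

⊛-congˡ : ∀ {f f′} g → f ≗ f′ → f ⊛ g ≗ f′ ⊛ g
⊛-congˡ {f} {f′} g f≗ = ⊛-cong {f} {f′} {g} {g} f≗ (λ _ → refl)

⊛-congʳ : ∀ f {g g′} → g ≗ g′ → f ⊛ g ≗ f ⊛ g′
⊛-congʳ f {g} {g′} g≗ = ⊛-cong {f} {f} {g} {g′} (λ _ → refl) g≗

⊛-comm : ∀ f g → f ⊛ g ≗ g ⊛ f
⊛-comm f g n = trans (sumUpTo-reverse n _) (sumUpTo-cong≤ n (λ k k≤n →
  trans (cong (λ i → f (n ∸ k) * g i) (ℕ.m∸[m∸n]≡n k≤n)) (*-comm (f (n ∸ k)) (g k))))

⊛-distribʳ : ∀ f g h → (f ⊕ g) ⊛ h ≗ (f ⊛ h) ⊕ (g ⊛ h)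
⊛-distribʳ f g h n =
  trans (sumUpTo-cong n (λ k → *-distribʳ-+ (h (n ∸ k)) (f k) (g k))) (sumUpTo-+ n _ _)

⊛-distribˡ : ∀ f g h → f ⊛ (g ⊕ h) ≗ (f ⊛ g) ⊕ (f ⊛ h)
⊛-distribˡ f g h n =
  trans (sumUpTo-cong n (λ k → *-distribˡ-+ (f k) (g (n ∸ k)) (h (n ∸ k)))) (sumUpTo-+ n _ _)

⊛-scaleˡ : ∀ c f g → (c · f) ⊛ g ≗ c · (f ⊛ g)
⊛-scaleˡ c f g n = trans (sumUpTo-cong n (λ k → *-assoc c (f k) _)) (sumUpTo-*ˡ n c _)

⊛-scaleʳ : ∀ c f g → f ⊛ (c · g) ≗ c · (f ⊛ g)
⊛-scaleʳ c f g n = trans (sumUpTo-cong n (λ k → x*[y*z]≡y*[x*z] (f k) c _)) (sumUpTo-*ˡ n c _)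
  where
  x*[y*z]≡y*[x*z] : ∀ x y z → x * (y * z) ≡ y * (x * z)
  x*[y*z]≡y*[x*z] = solve-∀

⊛-shiftˡ : ∀ f g → shift f ⊛ g ≗ shift (f ⊛ g)
⊛-shiftˡ f g zero    = refl
⊛-shiftˡ f g (suc n) = trans (⊛-suc (shift f) g n) (+-identityˡ _)

⊛-shiftʳ : ∀ f g → f ⊛ shift g ≗ shift (f ⊛ g)
⊛-shiftʳ f g n = trans (⊛-comm f (shift g) n)
                       (trans (⊛-shiftˡ g f n) (shift-cong (⊛-comm g f) n))

⊛-identityˡ : ∀ g → one ⊛ g ≗ g
⊛-identityˡ g zero    = *-identityˡ (g 0)
⊛-identityˡ g (suc n) = begin
  (one ⊛ g) (suc n)                           ≡⟨ ⊛-suc one g n ⟩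
  1ℤ * g (suc n) + (tail one ⊛ g) n           ≡⟨ cong₂ _+_ (*-identityˡ (g (suc n)))
                                                   (sumUpTo-cong n (λ k → *-zeroˡ (g (n ∸ k)))) ⟩
  g (suc n) + sumUpTo n (λ _ → 0ℤ)            ≡⟨ cong (_+_ (g (suc n))) (sumUpTo-zero n) ⟩
  g (suc n) + 0ℤ                              ≡⟨ +-identityʳ _ ⟩
  g (suc n)                                   ∎
  where open ≡-Reasoning

⊛-identityʳ : ∀ g → g ⊛ one ≗ g
⊛-identityʳ g n = trans (⊛-comm g one n) (⊛-identityˡ g n)

⊛-shift²ˡ : ∀ f g → shift (shift f) ⊛ g ≗ shift (shift (f ⊛ g))
⊛-shift²ˡ f g n = trans (⊛-shiftˡ (shift f) g n) (shift-cong (⊛-shiftˡ f g) n)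

⊛-assoc : ∀ f g h → (f ⊛ g) ⊛ h ≗ f ⊛ (g ⊛ h)
⊛-assoc f g h zero    = *-assoc (f 0) (g 0) (h 0)
⊛-assoc f g h (suc n) = begin
  ((f ⊛ g) ⊛ h) (suc n)
    ≡⟨ ⊛-suc (f ⊛ g) h n ⟩
  f 0 * g 0 * h (suc n) + (tail (f ⊛ g) ⊛ h) n
    ≡⟨ cong (_+_ (f 0 * g 0 * h (suc n))) (begin
        (tail (f ⊛ g) ⊛ h) n
          ≡⟨ ⊛-congˡ h (⊛-suc f g) n ⟩
        (((f 0 · tail g) ⊕ (tail f ⊛ g)) ⊛ h) n
          ≡⟨ ⊛-distribʳ (f 0 · tail g) (tail f ⊛ g) h n ⟩
        ((f 0 · tail g) ⊛ h) n + ((tail f ⊛ g) ⊛ h) n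
          ≡⟨ cong₂ _+_ (⊛-scaleˡ (f 0) (tail g) h n) (⊛-assoc (tail f) g h n) ⟩
        f 0 * (tail g ⊛ h) n + (tail f ⊛ (g ⊛ h)) n ∎) ⟩
  f 0 * g 0 * h (suc n) + (f 0 * (tail g ⊛ h) n + (tail f ⊛ (g ⊛ h)) n)
    ≡⟨ regroup (f 0) (g 0) (h (suc n)) _ _ ⟩
  f 0 * (g 0 * h (suc n) + (tail g ⊛ h) n) + (tail f ⊛ (g ⊛ h)) n
    ≡⟨ cong (λ z → f 0 * z + (tail f ⊛ (g ⊛ h)) n) (sym (⊛-suc g h n)) ⟩
  f 0 * (g ⊛ h) (suc n) + (tail f ⊛ (g ⊛ h)) n
    ≡⟨ sym (⊛-suc f (g ⊛ h) n) ⟩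
  (f ⊛ (g ⊛ h)) (suc n) ∎
  where
  open ≡-Reasoning
  regroup : ∀ a b c d e → a * b * c + (a * d + e) ≡ a * (b * c + d) + e
  regroup = solve-∀

-- Square roots

squareMiddle : Series → ℕ → ℤ
squareMiddle f zero    = 0ℤ
squareMiddle f (suc m) = sumUpTo m (λ k → f (suc k) * f (suc m ∸ k))

squareMiddle-cong : ∀ n {f g} → (∀ k → k ≤ n → f k ≡ g k) → squareMiddle f n ≡ squareMiddle g n
squareMiddle-cong zero    f≡g = refl
squareMiddle-cong (suc m) f≡g = sumUpTo-cong≤ m (λ k k≤m →
  cong₂ _*_ (f≡g (suc k) (s≤s k≤m)) (f≡g (suc m ∸ k) (ℕ.m∸n≤m (suc m) k)))

⊛-square-suc : ∀ f n → (f ⊛ f) (suc n) ≡ f 0 * f (suc n) + (squareMiddle f n + f (suc n) * f 0)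
⊛-square-suc f n = trans (⊛-suc f f n) (cong (_+_ (f 0 * f (suc n))) (last n))
  where
  last : ∀ n → (tail f ⊛ f) n ≡ squareMiddle f n + f (suc n) * f 0
  last zero    = sym (+-identityˡ (f 1 * f 0))
  last (suc m) = cong (λ i → squareMiddle f (suc m) + f (suc (suc m)) * f i) (ℕ.n∸n≡0 m)

open GroupProperties (AbelianGroup.group +-0-abelianGroup) using () renaming (∙-cancelʳ to +-cancelʳ)

sqrt-unique : ∀ f g → f ⊛ f ≗ g ⊛ g → f 0 ≡ 1ℤ → g 0 ≡ 1ℤ → f ≗ g
sqrt-unique f g f²≗g² f₀≡1 g₀≡1 = <-rec (λ n → f n ≡ g n) agree
  where
  square-suc : ∀ h → h 0 ≡ 1ℤ → ∀ n → (h ⊛ h) (suc n) ≡ + 2 * h (suc n) + squareMiddle h n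
  square-suc h h₀≡1 n = begin
    (h ⊛ h) (suc n)                                  ≡⟨ ⊛-square-suc h n ⟩
    h 0 * h (suc n) + (squareMiddle h n + h (suc n) * h 0)
      ≡⟨ cong (λ c → c * h (suc n) + (squareMiddle h n + h (suc n) * c)) h₀≡1 ⟩
    1ℤ * h (suc n) + (squareMiddle h n + h (suc n) * 1ℤ) ≡⟨ collect (h (suc n)) (squareMiddle h n) ⟩
    + 2 * h (suc n) + squareMiddle h n               ∎
    where
    open ≡-Reasoning
    collect : ∀ y m → 1ℤ * y + (m + y * 1ℤ) ≡ + 2 * y + m
    collect = solve-∀

  agree : ∀ n → (∀ {m} → m < n → f m ≡ g m) → f n ≡ g n
  agree zero    _  = trans f₀≡1 (sym g₀≡1)
  agree (suc n) ih = *-cancelˡ-≡ (+ 2) (f (suc n)) (g (suc n)) (+-cancelʳ (squareMiddle f n) _ _ (begin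
    + 2 * f (suc n) + squareMiddle f n  ≡⟨ sym (square-suc f f₀≡1 n) ⟩
    (f ⊛ f) (suc n)                     ≡⟨ f²≗g² (suc n) ⟩
    (g ⊛ g) (suc n)                     ≡⟨ square-suc g g₀≡1 n ⟩
    + 2 * g (suc n) + squareMiddle g n
      ≡⟨ cong (_+_ (+ 2 * g (suc n))) (sym (squareMiddle-cong n (λ k k≤n → ih (s≤s k≤n)))) ⟩
    + 2 * g (suc n) + squareMiddle f n  ∎))
    where open ≡-Reasoning

-- Series in u as even series in t

-- f(t) ↦ f(t²)
dilate : Series → Series
dilate f zero          = f 0
dilate f (suc zero)    = 0ℤ
dilate f (suc (suc n)) = dilate (tail f) n

double : ℕ → ℕ
double zero    = zero
double (suc n) = suc (suc (double n))

2*≡double : ∀ n → 2 ℕ.* n ≡ double n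
2*≡double zero    = refl
2*≡double (suc n) = cong suc (trans (ℕ.+-suc n (n ℕ.+ 0)) (cong suc (2*≡double n)))

even-or-odd : ∀ n → (∃ λ m → n ≡ double m) ⊎ (∃ λ m → n ≡ suc (double m))
even-or-odd zero = inj₁ (0 , refl)
even-or-odd (suc n) with even-or-odd n
... | inj₁ (m , refl) = inj₂ (m , refl)
... | inj₂ (m , refl) = inj₁ (suc m , refl)

parity-double : ∀ n → parity (double n) ≡ parity 0
parity-double zero    = refl
parity-double (suc n) = parity-double n

parity-suc : ∀ n → parity (suc n) ≡ parity n ⁻¹
parity-suc n = sym (⁻¹-selfInverse (suc-homo-⁻¹ n))

parity-suc-cong : ∀ m n → parity m ≡ parity n → parity (suc m) ≡ parity (suc n)
parity-suc-cong m n eq = trans (parity-suc m) (trans (cong _⁻¹ eq) (sym (parity-suc n)))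

parity-suc-swap : ∀ m n → parity (suc m) ≡ parity n → parity m ≡ parity (suc n)
parity-suc-swap m n eq =
  trans (sym (⁻¹-selfInverse (trans (sym (parity-suc m)) eq))) (sym (parity-suc n))

dilate-double : ∀ f n → dilate f (double n) ≡ f n
dilate-double f zero    = refl
dilate-double f (suc n) = dilate-double (tail f) n

dilate-odd : ∀ f n → dilate f (suc (double n)) ≡ 0ℤ
dilate-odd f zero    = refl
dilate-odd f (suc n) = dilate-odd (tail f) n

dilate-zero : ∀ {f} → (∀ k → f k ≡ 0ℤ) → ∀ n → dilate f n ≡ 0ℤ
dilate-zero f≡0 zero          = f≡0 0
dilate-zero f≡0 (suc zero)    = refl
dilate-zero f≡0 (suc (suc n)) = dilate-zero (λ k → f≡0 (suc k)) n

dilate-cong : ∀ {f g} → f ≗ g → dilate f ≗ dilate g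
dilate-cong f≗g zero          = f≗g 0
dilate-cong f≗g (suc zero)    = refl
dilate-cong f≗g (suc (suc n)) = dilate-cong (λ k → f≗g (suc k)) n

dilate-⊕ : ∀ f g → dilate (f ⊕ g) ≗ dilate f ⊕ dilate g
dilate-⊕ f g zero          = refl
dilate-⊕ f g (suc zero)    = refl
dilate-⊕ f g (suc (suc n)) = dilate-⊕ (tail f) (tail g) n

dilate-· : ∀ c f → dilate (c · f) ≗ c · dilate f
dilate-· c f zero          = refl
dilate-· c f (suc zero)    = sym (*-zeroʳ c)
dilate-· c f (suc (suc n)) = dilate-· c (tail f) n

dilate-shift : ∀ f → dilate (shift f) ≗ shift (shift (dilate f))
dilate-shift f zero          = refl
dilate-shift f (suc zero)    = refl
dilate-shift f (suc (suc n)) = refl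

dilate-split : ∀ f → dilate f ≗ (f 0 · one) ⊕ shift (shift (dilate (tail f)))
dilate-split f zero          = sym (trans (+-identityʳ (f 0 * 1ℤ)) (*-identityʳ (f 0)))
dilate-split f (suc zero)    = sym (trans (+-identityʳ (f 0 * 0ℤ)) (*-zeroʳ (f 0)))
dilate-split f (suc (suc n)) = sym (trans (cong (_+ dilate (tail f) n) (*-zeroʳ (f 0)))
                                          (+-identityˡ (dilate (tail f) n)))

dilate-⊛ : ∀ f g → dilate f ⊛ dilate g ≗ dilate (f ⊛ g)
dilate-⊛ f g n = trans (product-split n) (trans (cong (_+_ (f 0 * dilate g n)) (rest n)) (sym (dilated-split n)))
  where
  open ≡-Reasoning
  product-split : ∀ n → (dilate f ⊛ dilate g) n ≡
                        f 0 * dilate g n + shift (shift (dilate (tail f) ⊛ dilate g)) n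
  product-split n = begin
    (dilate f ⊛ dilate g) n
      ≡⟨ ⊛-congˡ (dilate g) (dilate-split f) n ⟩
    (((f 0 · one) ⊕ shift (shift (dilate (tail f)))) ⊛ dilate g) n
      ≡⟨ ⊛-distribʳ (f 0 · one) (shift (shift (dilate (tail f)))) (dilate g) n ⟩
    ((f 0 · one) ⊛ dilate g) n + (shift (shift (dilate (tail f))) ⊛ dilate g) n
      ≡⟨ cong₂ _+_ (trans (⊛-scaleˡ (f 0) one (dilate g) n) (cong (f 0 *_) (⊛-identityˡ (dilate g) n)))
                   (⊛-shift²ˡ (dilate (tail f)) (dilate g) n) ⟩
    f 0 * dilate g n + shift (shift (dilate (tail f) ⊛ dilate g)) n ∎
  dilated-split : ∀ n → dilate (f ⊛ g) n ≡ f 0 * dilate g n + shift (shift (dilate (tail f ⊛ g))) n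
  dilated-split n = begin
    dilate (f ⊛ g) n                                      ≡⟨ dilate-cong (⊛-split f g) n ⟩
    dilate ((f 0 · g) ⊕ shift (tail f ⊛ g)) n             ≡⟨ dilate-⊕ (f 0 · g) (shift (tail f ⊛ g)) n ⟩
    dilate (f 0 · g) n + dilate (shift (tail f ⊛ g)) n
      ≡⟨ cong₂ _+_ (dilate-· (f 0) g n) (dilate-shift (tail f ⊛ g) n) ⟩
    f 0 * dilate g n + shift (shift (dilate (tail f ⊛ g))) n ∎
  rest : ∀ n → shift (shift (dilate (tail f) ⊛ dilate g)) n ≡ shift (shift (dilate (tail f ⊛ g))) n
  rest zero          = refl
  rest (suc zero)    = refl
  rest (suc (suc n)) = dilate-⊛ (tail f) g n

dilate-poly3 : ∀ c₀ c₁ c₂ m →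
               dilate (poly3 c₀ c₁ c₂) (suc (suc m)) ≡ c₁ * one m + c₂ * shift (shift one) m
dilate-poly3 c₀ c₁ c₂ = coefficient
  where
  u*1+v*0≡u : ∀ u v → u * 1ℤ + v * 0ℤ ≡ u
  u*1+v*0≡u = solve-∀
  u*0+v*0≡0 : ∀ u v → u * 0ℤ + v * 0ℤ ≡ 0ℤ
  u*0+v*0≡0 = solve-∀
  coefficient : ∀ m → dilate (poly3 c₀ c₁ c₂) (suc (suc m)) ≡ c₁ * one m + c₂ * shift (shift one) m
  coefficient 0                         = sym (u*1+v*0≡u c₁ c₂)
  coefficient 1                         = sym (u*0+v*0≡0 c₁ c₂)
  coefficient 2                         = sym (trans (+-comm (c₁ * 0ℤ) (c₂ * 1ℤ)) (u*1+v*0≡u c₂ c₁))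
  coefficient 3                         = sym (u*0+v*0≡0 c₁ c₂)
  coefficient (suc (suc (suc (suc m)))) = trans (dilate-zero (λ _ → refl) m) (sym (u*0+v*0≡0 c₁ c₂))


-- Sums over step words

sumℤ : List ℤ → ℤ
sumℤ = foldr _+_ 0ℤ

sumℤ-++ : ∀ xs ys → sumℤ (xs ++ ys) ≡ sumℤ xs + sumℤ ys
sumℤ-++ []       ys = sym (+-identityˡ _)
sumℤ-++ (x ∷ xs) ys rewrite sumℤ-++ xs ys = sym (+-assoc x (sumℤ xs) (sumℤ ys))

module _ {A : Set} where

  sumOver : (A → ℤ) → List A → ℤ
  sumOver f l = sumℤ (map f l)

  sumOver-cong : ∀ l {f g : A → ℤ} → f ≗ g → sumOver f l ≡ sumOver g l
  sumOver-cong []      f≗g = refl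
  sumOver-cong (w ∷ l) f≗g = cong₂ _+_ (f≗g w) (sumOver-cong l f≗g)

  sumOver-+ : ∀ l (f g : A → ℤ) → sumOver (λ w → f w + g w) l ≡ sumOver f l + sumOver g l
  sumOver-+ []      f g = refl
  sumOver-+ (w ∷ l) f g rewrite sumOver-+ l f g = +-interchange (f w) (g w) (sumOver f l) (sumOver g l)
    where
    +-interchange : ∀ a b c d → a + b + (c + d) ≡ a + c + (b + d)
    +-interchange = solve-∀

  sumOver-*ˡ : ∀ l c (f : A → ℤ) → sumOver (λ w → c * f w) l ≡ c * sumOver f l
  sumOver-*ˡ []      c f = sym (*-zeroʳ c)
  sumOver-*ˡ (w ∷ l) c f rewrite sumOver-*ˡ l c f = sym (*-distribˡ-+ c (f w) (sumOver f l))

  sumOver-zero : ∀ l → sumOver (λ _ → 0ℤ) l ≡ 0ℤ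
  sumOver-zero []      = refl
  sumOver-zero (w ∷ l) = trans (+-identityˡ _) (sumOver-zero l)

  sumOver-filter : ∀ (P : A → Bool) (g : A → ℤ) l →
    sumOver g (filter (λ w → P w ≟B true) l) ≡ sumOver (λ w → if P w then g w else 0ℤ) l
  sumOver-filter P g []      = refl
  sumOver-filter P g (w ∷ l) with P w
  ... | true  = cong (_+_ (g w)) (sumOver-filter P g l)
  ... | false = trans (sumOver-filter P g l) (sym (+-identityˡ _))

sumOver-concatMap : ∀ {A B : Set} (f : B → ℤ) (g : A → List B) l →
  sumOver f (concatMap g l) ≡ sumOver (λ w → sumOver f (g w)) l
sumOver-concatMap f g []      = refl
sumOver-concatMap f g (w ∷ l) = begin
  sumℤ (map f (g w ++ concatMap g l))              ≡⟨ cong sumℤ (map-++ f (g w) (concatMap g l)) ⟩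
  sumℤ (map f (g w) ++ map f (concatMap g l))      ≡⟨ sumℤ-++ (map f (g w)) _ ⟩
  sumOver f (g w) + sumOver f (concatMap g l)      ≡⟨ cong (_+_ (sumOver f (g w))) (sumOver-concatMap f g l) ⟩
  sumOver f (g w) + sumOver (λ w → sumOver f (g w)) l ∎
  where open ≡-Reasoning

sumWords : ℕ → (List Step → ℤ) → ℤ
sumWords n f = sumOver f (words n)

sumWords-suc : ∀ n f → sumWords (suc n) f ≡
  sumWords n (λ w → f ((up , red) ∷ w)) + sumWords n (λ w → f ((up , blue) ∷ w))
  + (sumWords n (λ w → f ((down , red) ∷ w)) + sumWords n (λ w → f ((down , blue) ∷ w)))
sumWords-suc n f = begin
  sumOver f (concatMap _ (words n))
    ≡⟨ sumOver-concatMap f _ (words n) ⟩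
  sumWords n (λ w → f (ur ∷ w) + (f (ub ∷ w) + (f (dr ∷ w) + (f (db ∷ w) + 0ℤ))))
    ≡⟨ sumOver-cong (words n) (λ w → regroup (f (ur ∷ w)) (f (ub ∷ w)) (f (dr ∷ w)) (f (db ∷ w))) ⟩
  sumWords n (λ w → f (ur ∷ w) + f (ub ∷ w) + (f (dr ∷ w) + f (db ∷ w)))
    ≡⟨ trans (sumOver-+ (words n) _ _) (cong₂ _+_ (sumOver-+ (words n) _ _) (sumOver-+ (words n) _ _)) ⟩
  _ ∎
  where
  open ≡-Reasoning
  ur ub dr db : Step
  ur = up , red
  ub = up , blue
  dr = down , red
  db = down , blue
  regroup : ∀ a b c d → a + (b + (c + (d + 0ℤ))) ≡ a + b + (c + d)
  regroup = solve-∀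

sumWords-zero : ∀ n → sumWords n (λ _ → 0ℤ) ≡ 0ℤ
sumWords-zero n = sumOver-zero (words n)

sumWords-*ˡ : ∀ n c f → sumWords n (λ w → c * f w) ≡ c * sumWords n f
sumWords-*ˡ n = sumOver-*ˡ (words n)

module WeightedPaths (a x : ℤ) where
  open ≡-Reasoning

  -- The state `just c` records that the previous step was an up-step of colour c.
  peakFactor : Maybe Colour → Colour → ℤ
  peakFactor nothing   c = 1ℤ
  peakFactor (just c₀) c = if differentColour c₀ c then a else 1ℤ

  -- Zero unless w is a valid path suffix from height h; otherwise a per multicoloured peak
  -- and x per vertex at height 1, collected when the path leaves that vertex.
  weight : ℕ → Maybe Colour → List Step → ℤ
  weight zero          _ []                     = 1ℤ
  weight (suc _)       _ []                     = 0ℤ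
  weight zero          _ ((up , red) ∷ s)       = weight 1 (just red) s
  weight (suc zero)    _ ((up , red) ∷ s)       = x * weight 2 (just red) s
  weight (suc zero)    p ((down , red) ∷ s)     = x * (peakFactor p red * weight 0 nothing s)
  weight (suc (suc h)) _ ((up , c) ∷ s)         = weight (suc (suc (suc h))) (just c) s
  weight (suc (suc h)) p ((down , c) ∷ s)       = peakFactor p c * weight (suc h) nothing s
  weight _             _ _                      = 0ℤ

  peaksAfter : Maybe Colour → List Step → ℕ
  peaksAfter nothing  w = peaks w
  peaksAfter (just c) w = peaks ((up , c) ∷ w)

  valid-from : ℕ → List Step → Bool
  valid-from h w = dyckFrom h w ∧ lowRedFrom h w

  summand : ℕ → Maybe Colour → List Step → ℤ
  summand h p w = if valid-from h w then a ^ peaksAfter p w * x ^ heightOneFrom h w else 0ℤ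

  peaksAfter-down : ∀ p c s → a ^ peaksAfter p ((down , c) ∷ s) ≡ peakFactor p c * a ^ peaks s
  peaksAfter-down nothing     c    s = sym (*-identityˡ _)
  peaksAfter-down (just red)  red  s = sym (*-identityˡ _)
  peaksAfter-down (just red)  blue s = refl
  peaksAfter-down (just blue) red  s = refl
  peaksAfter-down (just blue) blue s = sym (*-identityˡ _)

  if-scale : ∀ b {u v} k → u ≡ k * v → (if b then u else 0ℤ) ≡ k * (if b then v else 0ℤ)
  if-scale true  k u≡kv = u≡kv
  if-scale false k _    = sym (*-zeroʳ k)

  x*[y*z]≡y*[x*z] : ∀ u v w → u * (v * w) ≡ v * (u * w)
  x*[y*z]≡y*[x*z] = solve-∀

  summand≡weight : ∀ h p w → summand h p w ≡ weight h p w
  summand≡weight zero          nothing  []                 = refl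
  summand≡weight zero          (just _) []                 = refl
  summand≡weight (suc h)       p        []                 = refl
  summand≡weight zero          nothing  ((up , red) ∷ s)   = summand≡weight 1 (just red) s
  summand≡weight zero          (just _) ((up , red) ∷ s)   = summand≡weight 1 (just red) s
  summand≡weight zero          p        ((up , blue) ∷ s)  rewrite ∧-zeroʳ (dyckFrom 1 s) = refl
  summand≡weight zero          p        ((down , c) ∷ s)   = refl
  summand≡weight (suc zero)    p        ((up , red) ∷ s)   = begin
    summand 1 p ((up , red) ∷ s)
      ≡⟨ if-scale (valid-from 2 s) x (redUpPeaks p) ⟩
    x * summand 2 (just red) s ≡⟨ cong (x *_) (summand≡weight 2 (just red) s) ⟩
    x * weight 2 (just red) s  ∎
    where
    redUpPeaks : ∀ p → a ^ peaksAfter p ((up , red) ∷ s) * (x * x ^ heightOneFrom 2 s)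
                     ≡ x * (a ^ peaks ((up , red) ∷ s) * x ^ heightOneFrom 2 s)
    redUpPeaks nothing  = x*[y*z]≡y*[x*z] (a ^ peaks ((up , red) ∷ s)) x (x ^ heightOneFrom 2 s)
    redUpPeaks (just _) = x*[y*z]≡y*[x*z] (a ^ peaks ((up , red) ∷ s)) x (x ^ heightOneFrom 2 s)
  summand≡weight (suc zero)    p        ((up , blue) ∷ s)  rewrite ∧-zeroʳ (dyckFrom 2 s) = refl
  summand≡weight (suc zero)    p        ((down , red) ∷ s) = begin
    summand 1 p ((down , red) ∷ s)
      ≡⟨ if-scale (valid-from 0 s) x
           (trans (cong (_* (x * x ^ heightOneFrom 0 s)) (peaksAfter-down p red s))
                  (x*[y*z]≡y*[x*z] (peakFactor p red * a ^ peaks s) x (x ^ heightOneFrom 0 s))) ⟩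
    x * (if valid-from 0 s then peakFactor p red * a ^ peaks s * x ^ heightOneFrom 0 s else 0ℤ)
      ≡⟨ cong (x *_) (if-scale (valid-from 0 s) (peakFactor p red)
                               (*-assoc (peakFactor p red) (a ^ peaks s) (x ^ heightOneFrom 0 s))) ⟩
    x * (peakFactor p red * summand 0 nothing s)
      ≡⟨ cong (λ z → x * (peakFactor p red * z)) (summand≡weight 0 nothing s) ⟩
    x * (peakFactor p red * weight 0 nothing s) ∎
  summand≡weight (suc zero)    p        ((down , blue) ∷ s) rewrite ∧-zeroʳ (dyckFrom 0 s) = refl
  summand≡weight (suc (suc h)) nothing  ((up , c) ∷ s)     = summand≡weight (suc (suc (suc h))) (just c) s
  summand≡weight (suc (suc h)) (just _) ((up , c) ∷ s)     = summand≡weight (suc (suc (suc h))) (just c) s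
  summand≡weight (suc (suc h)) p        ((down , c) ∷ s)   = begin
    summand (suc (suc h)) p ((down , c) ∷ s)
      ≡⟨ if-scale (valid-from (suc h) s) (peakFactor p c)
           (trans (cong (_* x ^ heightOneFrom (suc h) s) (peaksAfter-down p c s))
                  (*-assoc (peakFactor p c) (a ^ peaks s) (x ^ heightOneFrom (suc h) s))) ⟩
    peakFactor p c * summand (suc h) nothing s
      ≡⟨ cong (peakFactor p c *_) (summand≡weight (suc h) nothing s) ⟩
    peakFactor p c * weight (suc h) nothing s  ∎

  T≡sumWords-weight : ∀ n → T a x n ≡ sumWords (2 ℕ.* n) (weight 0 nothing)
  T≡sumWords-weight n =
    trans (sumOver-filter valid (λ w → a ^ peaks w * x ^ heightOneVertices w) (words (2 ℕ.* n)))
          (sumOver-cong (words (2 ℕ.* n)) (summand≡weight 0 nothing))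

  pathSeries : ℕ → Maybe Colour → Series
  pathSeries h p n = sumWords n (weight h p)

  pathSeries₀-suc : ∀ p n → pathSeries 0 p (suc n) ≡ pathSeries 1 (just red) n
  pathSeries₀-suc p n = begin
    pathSeries 0 p (suc n)
      ≡⟨ sumWords-suc n (weight 0 p) ⟩
    pathSeries 1 (just red) n + sumWords n (λ _ → 0ℤ) + (sumWords n (λ _ → 0ℤ) + sumWords n (λ _ → 0ℤ))
      ≡⟨ cong (λ z → pathSeries 1 (just red) n + z + (z + z)) (sumWords-zero n) ⟩
    pathSeries 1 (just red) n + 0ℤ + 0ℤ
      ≡⟨ trans (+-identityʳ _) (+-identityʳ _) ⟩
    pathSeries 1 (just red) n ∎

  pathSeries₁-suc : ∀ p n → pathSeries 1 p (suc n) ≡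
    x * pathSeries 2 (just red) n + x * (peakFactor p red * pathSeries 0 nothing n)
  pathSeries₁-suc p n = begin
    pathSeries 1 p (suc n)
      ≡⟨ sumWords-suc n (weight 1 p) ⟩
    up-red + sumWords n (λ _ → 0ℤ) + (down-red + sumWords n (λ _ → 0ℤ))
      ≡⟨ cong (λ z → up-red + z + (down-red + z)) (sumWords-zero n) ⟩
    up-red + 0ℤ + (down-red + 0ℤ)
      ≡⟨ cong₂ _+_ (+-identityʳ up-red) (+-identityʳ down-red) ⟩
    up-red + down-red
      ≡⟨ cong₂ _+_ (sumWords-*ˡ n x (weight 2 (just red)))
                   (trans (sumWords-*ˡ n x (λ w → peakFactor p red * weight 0 nothing w))
                          (cong (x *_) (sumWords-*ˡ n (peakFactor p red) (weight 0 nothing)))) ⟩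
    x * pathSeries 2 (just red) n + x * (peakFactor p red * pathSeries 0 nothing n) ∎
    where
    up-red down-red : ℤ
    up-red   = sumWords n (λ w → x * weight 2 (just red) w)
    down-red = sumWords n (λ w → x * (peakFactor p red * weight 0 nothing w))

  -- the recurrence obeyed by G at height suc h when the first step is unrestricted
  freeStep : (ℕ → Maybe Colour → Series) → ℕ → Maybe Colour → ℕ → ℤ
  freeStep G h p n = G (suc (suc h)) (just red) n + G (suc (suc h)) (just blue) n
                   + (peakFactor p red * G h nothing n + peakFactor p blue * G h nothing n)

  pathSeries₂₊-suc : ∀ h p n → pathSeries (suc (suc h)) p (suc n) ≡ freeStep pathSeries (suc h) p n
  pathSeries₂₊-suc h p n = trans (sumWords-suc n (weight (suc (suc h)) p))
    (cong (_+_ (pathSeries (suc (suc (suc h))) (just red) n + pathSeries (suc (suc (suc h))) (just blue) n))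
          (cong₂ _+_ (sumWords-*ˡ n (peakFactor p red) (weight (suc h) nothing))
                     (sumWords-*ˡ n (peakFactor p blue) (weight (suc h) nothing))))

  pathSeries-vanishes : ∀ n h p → parity h ≡ parity (suc n) → pathSeries h p n ≡ 0ℤ
  pathSeries-vanishes zero    zero          p ()
  pathSeries-vanishes zero    (suc h)       p _  = refl
  pathSeries-vanishes (suc n) zero          p eq =
    trans (pathSeries₀-suc p n) (pathSeries-vanishes n 1 (just red) (parity-suc-cong 0 n eq))
  pathSeries-vanishes (suc n) (suc zero)    p eq = begin
    pathSeries 1 p (suc n)
      ≡⟨ pathSeries₁-suc p n ⟩
    x * pathSeries 2 (just red) n + x * (peakFactor p red * pathSeries 0 nothing n)
      ≡⟨ cong₂ (λ u v → x * u + x * (peakFactor p red * v))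
               (pathSeries-vanishes n 2 (just red) (parity-suc-cong 1 n eq))
               (pathSeries-vanishes n 0 nothing (parity-suc-swap 0 n eq)) ⟩
    x * 0ℤ + x * (peakFactor p red * 0ℤ)
      ≡⟨ x*0+x*[y*0]≡0 x (peakFactor p red) ⟩
    0ℤ ∎
    where
    x*0+x*[y*0]≡0 : ∀ u v → u * 0ℤ + u * (v * 0ℤ) ≡ 0ℤ
    x*0+x*[y*0]≡0 = solve-∀
  pathSeries-vanishes (suc n) (suc (suc h)) p eq = begin
    pathSeries (suc (suc h)) p (suc n)
      ≡⟨ pathSeries₂₊-suc h p n ⟩
    freeStep pathSeries (suc h) p n
      ≡⟨ cong₂ (λ u v → u + v)
           (cong₂ _+_ (pathSeries-vanishes n (suc (suc (suc h))) (just red) (parity-suc-cong h n eq))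
                      (pathSeries-vanishes n (suc (suc (suc h))) (just blue) (parity-suc-cong h n eq)))
           (cong (λ v → peakFactor p red * v + peakFactor p blue * v)
                 (pathSeries-vanishes n (suc h) nothing (parity-suc-cong h n eq))) ⟩
    0ℤ + 0ℤ + (peakFactor p red * 0ℤ + peakFactor p blue * 0ℤ)
      ≡⟨ 0+0+[x*0+y*0]≡0 (peakFactor p red) (peakFactor p blue) ⟩
    0ℤ ∎
    where
    0+0+[x*0+y*0]≡0 : ∀ u v → 0ℤ + 0ℤ + (u * 0ℤ + v * 0ℤ) ≡ 0ℤ
    0+0+[x*0+y*0]≡0 = solve-∀

  -- paths with no colour restriction, stopped on their first visit to height 0
  freeWeight : ℕ → Maybe Colour → List Step → ℤ
  freeWeight zero    _ []               = 1ℤ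
  freeWeight (suc h) _ ((up , c) ∷ s)   = freeWeight (suc (suc h)) (just c) s
  freeWeight (suc h) p ((down , c) ∷ s) = peakFactor p c * freeWeight h nothing s
  freeWeight _       _ _                = 0ℤ

  freeSeries : ℕ → Maybe Colour → Series
  freeSeries h p n = sumWords n (freeWeight h p)

  freeSeries₀ : ∀ p → freeSeries 0 p ≗ one
  freeSeries₀ p zero    = refl
  freeSeries₀ p (suc n) =
    trans (sumWords-suc n (freeWeight 0 p)) (cong (λ z → z + z + (z + z)) (sumWords-zero n))

  freeSeries-suc : ∀ h p n → freeSeries (suc h) p (suc n) ≡ freeStep freeSeries h p n
  freeSeries-suc h p n = trans (sumWords-suc n (freeWeight (suc h) p))
    (cong (_+_ (freeSeries (suc (suc h)) (just red) n + freeSeries (suc (suc h)) (just blue) n))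
          (cong₂ _+_ (sumWords-*ˡ n (peakFactor p red) (freeWeight h nothing))
                     (sumWords-*ˡ n (peakFactor p blue) (freeWeight h nothing))))

  firstPassage : Maybe Colour → Series
  firstPassage = freeSeries 1

  firstPassage-⊛-suc : ∀ p G n → (firstPassage p ⊛ G) (suc n) ≡
    (freeSeries 2 (just red) ⊛ G) n + (freeSeries 2 (just blue) ⊛ G) n
    + (peakFactor p red * G n + peakFactor p blue * G n)
  firstPassage-⊛-suc p G n = begin
    (firstPassage p ⊛ G) (suc n)
      ≡⟨ trans (⊛-suc (firstPassage p) G n) (+-identityˡ _) ⟩
    (tail (firstPassage p) ⊛ G) n
      ≡⟨ ⊛-congˡ G (λ k → trans (freeSeries-suc 0 p k)
                              (cong (λ z → freeSeries 2 (just red) k + freeSeries 2 (just blue) k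
                                               + (peakFactor p red * z + peakFactor p blue * z))
                                    (freeSeries₀ nothing k))) n ⟩
    (((Dʳ ⊕ Dᵇ) ⊕ ((peakFactor p red · one) ⊕ (peakFactor p blue · one))) ⊛ G) n
      ≡⟨ ⊛-distribʳ (Dʳ ⊕ Dᵇ) ((peakFactor p red · one) ⊕ (peakFactor p blue · one)) G n ⟩
    ((Dʳ ⊕ Dᵇ) ⊛ G) n + (((peakFactor p red · one) ⊕ (peakFactor p blue · one)) ⊛ G) n
      ≡⟨ cong₂ _+_ (⊛-distribʳ Dʳ Dᵇ G n)
                   (trans (⊛-distribʳ (peakFactor p red · one) (peakFactor p blue · one) G n)
                          (cong₂ _+_ (scaled-one (peakFactor p red)) (scaled-one (peakFactor p blue)))) ⟩
    (Dʳ ⊛ G) n + (Dᵇ ⊛ G) n + (peakFactor p red * G n + peakFactor p blue * G n) ∎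
    where
    Dʳ Dᵇ : Series
    Dʳ = freeSeries 2 (just red)
    Dᵇ = freeSeries 2 (just blue)
    scaled-one : ∀ c → ((c · one) ⊛ G) n ≡ c * G n
    scaled-one c = trans (⊛-scaleˡ c one G n) (cong (c *_) (⊛-identityˡ G n))

  -- cut a path at its first visit to height h+1
  Factorises : (ℕ → Maybe Colour → Series) → ℕ → Set
  Factorises G n = ∀ h p → G (suc (suc h)) p n ≡ (firstPassage p ⊛ G (suc h) nothing) n

  module FirstPassage (G : ℕ → Maybe Colour → Series)
                      (G-suc : ∀ h p n → G (suc (suc h)) p (suc n) ≡ freeStep G (suc h) p n)
                      (G-zero : ∀ h p → G (suc (suc h)) p 0 ≡ 0ℤ) where

    factorises-zero : Factorises G 0
    factorises-zero h p = trans (G-zero h p) (sym (*-zeroˡ (G (suc h) nothing 0)))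

    factorises-suc : ∀ n → (∀ k → k ≤ n → Factorises freeSeries k) → (∀ k → k ≤ n → Factorises G k) →
                     Factorises G (suc n)
    factorises-suc n free-ih ih h p = begin
      G (suc (suc h)) p (suc n)
        ≡⟨ G-suc h p n ⟩
      freeStep G (suc h) p n
        ≡⟨ cong (_+ (peakFactor p red * G (suc h) nothing n + peakFactor p blue * G (suc h) nothing n))
                (cong₂ _+_ (after-up red) (after-up blue)) ⟩
      (freeSeries 2 (just red) ⊛ G (suc h) nothing) n + (freeSeries 2 (just blue) ⊛ G (suc h) nothing) n
      + (peakFactor p red * G (suc h) nothing n + peakFactor p blue * G (suc h) nothing n)
        ≡⟨ sym (firstPassage-⊛-suc p (G (suc h) nothing) n) ⟩
      (firstPassage p ⊛ G (suc h) nothing) (suc n) ∎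
      where
      after-up : ∀ c → G (suc (suc (suc h))) (just c) n ≡ (freeSeries 2 (just c) ⊛ G (suc h) nothing) n
      after-up c = begin
        G (suc (suc (suc h))) (just c) n
          ≡⟨ ih n ℕ.≤-refl (suc h) (just c) ⟩
        (firstPassage (just c) ⊛ G (suc (suc h)) nothing) n
          ≡⟨ ⊛-cong≤ n {f = firstPassage (just c)} {g′ = firstPassage nothing ⊛ G (suc h) nothing}
                    (λ _ _ → refl) (λ k k≤n → ih k k≤n h nothing) ⟩
        (firstPassage (just c) ⊛ (firstPassage nothing ⊛ G (suc h) nothing)) n
          ≡⟨ sym (⊛-assoc (firstPassage (just c)) (firstPassage nothing) (G (suc h) nothing) n) ⟩
        ((firstPassage (just c) ⊛ firstPassage nothing) ⊛ G (suc h) nothing) n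
          ≡⟨ ⊛-cong≤ n {f′ = freeSeries 2 (just c)} {g = G (suc h) nothing}
                    (λ k k≤n → sym (free-ih k k≤n 0 (just c))) (λ _ _ → refl) ⟩
        (freeSeries 2 (just c) ⊛ G (suc h) nothing) n ∎

  factorises-all : ∀ {G} → Factorises G 0 →
    (∀ n → (∀ k → k ≤ n → Factorises G k) → Factorises G (suc n)) → ∀ n → Factorises G n
  factorises-all {G} base step = <-rec (Factorises G) λ where
    zero    _  → base
    (suc n) ih → step n (λ k k≤n → ih (s≤s k≤n))

  freeSeries-factorises : ∀ n → Factorises freeSeries n
  freeSeries-factorises = factorises-all {freeSeries} Free.factorises-zero
                            (λ n ih → Free.factorises-suc n ih ih)
    where module Free = FirstPassage freeSeries (λ h → freeSeries-suc (suc h)) (λ _ _ → refl)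

  pathSeries-factorises : ∀ n → Factorises pathSeries n
  pathSeries-factorises = factorises-all {pathSeries} Path.factorises-zero
                            (λ n → Path.factorises-suc n (λ k _ → freeSeries-factorises k))
    where module Path = FirstPassage pathSeries pathSeries₂₊-suc (λ _ _ → refl)

  -- Generating functions

  F Fʳ : Series
  F  = firstPassage nothing
  Fʳ = firstPassage (just red)

  firstPassage-blue≗red : firstPassage (just blue) ≗ Fʳ
  firstPassage-blue≗red zero    = refl
  firstPassage-blue≗red (suc k) = begin
    firstPassage (just blue) (suc k)           ≡⟨ freeSeries-suc 0 (just blue) k ⟩
    Dʳ + Dᵇ + (a * freeSeries 0 nothing k + 1ℤ * freeSeries 0 nothing k)
      ≡⟨ cong (_+_ (Dʳ + Dᵇ)) (+-comm (a * freeSeries 0 nothing k) (1ℤ * freeSeries 0 nothing k)) ⟩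
    Dʳ + Dᵇ + (1ℤ * freeSeries 0 nothing k + a * freeSeries 0 nothing k)
      ≡⟨ sym (freeSeries-suc 0 (just red) k) ⟩
    Fʳ (suc k)                                 ∎
    where
    Dʳ Dᵇ : ℤ
    Dʳ = freeSeries 2 (just red) k
    Dᵇ = freeSeries 2 (just blue) k

  freeSeries₂ : ∀ c k → freeSeries 2 (just c) k ≡ (Fʳ ⊛ F) k
  freeSeries₂ red  k = freeSeries-factorises k 0 (just red)
  freeSeries₂ blue k = trans (freeSeries-factorises k 0 (just blue)) (⊛-congˡ F firstPassage-blue≗red k)

  firstPassage-suc : ∀ p k → firstPassage p (suc k) ≡
    + 2 * (Fʳ ⊛ F) k + (peakFactor p red + peakFactor p blue) * one k
  firstPassage-suc p k = begin
    firstPassage p (suc k)                    ≡⟨ freeSeries-suc 0 p k ⟩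
    freeSeries 2 (just red) k + freeSeries 2 (just blue) k
    + (peakFactor p red * freeSeries 0 nothing k + peakFactor p blue * freeSeries 0 nothing k)
      ≡⟨ cong₂ (λ u v → u + (peakFactor p red * v + peakFactor p blue * v))
               (cong₂ _+_ (freeSeries₂ red k) (freeSeries₂ blue k)) (freeSeries₀ nothing k) ⟩
    (Fʳ ⊛ F) k + (Fʳ ⊛ F) k + (peakFactor p red * one k + peakFactor p blue * one k)
      ≡⟨ collect ((Fʳ ⊛ F) k) (peakFactor p red) (peakFactor p blue) (one k) ⟩
    + 2 * (Fʳ ⊛ F) k + (peakFactor p red + peakFactor p blue) * one k ∎
    where
    collect : ∀ A r b d → A + A + (r * d + b * d) ≡ + 2 * A + (r + b) * d
    collect = solve-∀

  -- Fʳ and F differ only on the single down-step, weighted 1 + a after a red up-step and 2 otherwise.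
  Fʳ≗F+[a-1]t : Fʳ ≗ F ⊕ ((a - 1ℤ) · shift one)
  Fʳ≗F+[a-1]t zero    = sym (trans (+-identityˡ _) (*-zeroʳ (a - 1ℤ)))
  Fʳ≗F+[a-1]t (suc k) = begin
    Fʳ (suc k)                                   ≡⟨ firstPassage-suc (just red) k ⟩
    + 2 * (Fʳ ⊛ F) k + (1ℤ + a) * one k          ≡⟨ split a ((Fʳ ⊛ F) k) (one k) ⟩
    + 2 * (Fʳ ⊛ F) k + (1ℤ + 1ℤ) * one k + (a - 1ℤ) * one k
      ≡⟨ cong (_+ (a - 1ℤ) * one k) (sym (firstPassage-suc nothing k)) ⟩
    F (suc k) + (a - 1ℤ) * one k                 ∎
    where
    split : ∀ a A d → + 2 * A + (1ℤ + a) * d ≡ + 2 * A + (1ℤ + 1ℤ) * d + (a - 1ℤ) * d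
    split = solve-∀

  F-quadratic : ∀ m → F (suc m) ≡ + 2 * (F ⊛ F) m + + 2 * (a - 1ℤ) * shift F m + + 2 * one m
  F-quadratic m = begin
    F (suc m)                                                    ≡⟨ firstPassage-suc nothing m ⟩
    + 2 * (Fʳ ⊛ F) m + (1ℤ + 1ℤ) * one m                         ≡⟨ cong (λ z → + 2 * z + (1ℤ + 1ℤ) * one m) Fʳ⊛F ⟩
    + 2 * ((F ⊛ F) m + (a - 1ℤ) * shift F m) + (1ℤ + 1ℤ) * one m  ≡⟨ expand a ((F ⊛ F) m) (shift F m) (one m) ⟩
    + 2 * (F ⊛ F) m + + 2 * (a - 1ℤ) * shift F m + + 2 * one m    ∎
    where
    expand : ∀ a FF sF d →
             + 2 * (FF + (a - 1ℤ) * sF) + (1ℤ + 1ℤ) * d ≡ + 2 * FF + + 2 * (a - 1ℤ) * sF + + 2 * d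
    expand = solve-∀
    Fʳ⊛F : (Fʳ ⊛ F) m ≡ (F ⊛ F) m + (a - 1ℤ) * shift F m
    Fʳ⊛F = begin
      (Fʳ ⊛ F) m                                          ≡⟨ ⊛-congˡ F Fʳ≗F+[a-1]t m ⟩
      ((F ⊕ ((a - 1ℤ) · shift one)) ⊛ F) m                ≡⟨ ⊛-distribʳ F ((a - 1ℤ) · shift one) F m ⟩
      (F ⊛ F) m + (((a - 1ℤ) · shift one) ⊛ F) m
        ≡⟨ cong (_+_ ((F ⊛ F) m)) (trans (⊛-scaleˡ (a - 1ℤ) (shift one) F m)
             (cong ((a - 1ℤ) *_) (trans (⊛-shiftˡ one F m) (shift-cong (⊛-identityˡ F) m)))) ⟩
      (F ⊛ F) m + (a - 1ℤ) * shift F m                    ∎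

  c₂ : ℤ
  c₂ = + 2 - + 2 * a

  -- the square root of the radicand at u = t², in terms of F
  sqrtSeries : Series
  sqrtSeries = (one ⊕ (c₂ · shift (shift one))) ⊕ ((- + 4) · shift F)

  sqrtSeries₀ : sqrtSeries 0 ≡ 1ℤ
  sqrtSeries₀ = 1+c*0+d*0≡1 c₂ (- + 4)
    where
    1+c*0+d*0≡1 : ∀ c d → 1ℤ + c * 0ℤ + d * 0ℤ ≡ 1ℤ
    1+c*0+d*0≡1 = solve-∀

  sqrtSeries-⊛ : ∀ X n → (sqrtSeries ⊛ X) n ≡ X n + c₂ * shift (shift X) n + (- + 4) * shift (F ⊛ X) n
  sqrtSeries-⊛ X n = begin
    (sqrtSeries ⊛ X) n
      ≡⟨ ⊛-distribʳ (one ⊕ (c₂ · shift (shift one))) ((- + 4) · shift F) X n ⟩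
    ((one ⊕ (c₂ · shift (shift one))) ⊛ X) n + (((- + 4) · shift F) ⊛ X) n
      ≡⟨ cong₂ _+_ (⊛-distribʳ one (c₂ · shift (shift one)) X n)
                   (trans (⊛-scaleˡ (- + 4) (shift F) X n) (cong ((- + 4) *_) (⊛-shiftˡ F X n))) ⟩
    (one ⊛ X) n + ((c₂ · shift (shift one)) ⊛ X) n + (- + 4) * shift (F ⊛ X) n
      ≡⟨ cong₂ (λ u v → u + v + (- + 4) * shift (F ⊛ X) n) (⊛-identityˡ X n)
               (trans (⊛-scaleˡ c₂ (shift (shift one)) X n)
                      (cong (c₂ *_) (trans (⊛-shift²ˡ one X n) (shift-cong (shift-cong (⊛-identityˡ X)) n)))) ⟩
    X n + c₂ * shift (shift X) n + (- + 4) * shift (F ⊛ X) n ∎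

  sqrtSeries-squared : sqrtSeries ⊛ sqrtSeries ≗ dilate (radicand a)
  sqrtSeries-squared zero          = cong (λ c → c * c) sqrtSeries₀
  sqrtSeries-squared (suc zero)    = trans (sqrtSeries-⊛ sqrtSeries 1) (vanishes a)
    where
    vanishes : ∀ a → 0ℤ + (+ 2 - + 2 * a) * 0ℤ + (- + 4) * 0ℤ + (+ 2 - + 2 * a) * 0ℤ
                     + (- + 4) * (0ℤ * (1ℤ + (+ 2 - + 2 * a) * 0ℤ + (- + 4) * 0ℤ)) ≡ 0ℤ
    vanishes = solve-∀
  sqrtSeries-squared (suc (suc m)) = begin
    (sqrtSeries ⊛ sqrtSeries) (suc (suc m))
      ≡⟨ sqrtSeries-⊛ sqrtSeries (suc (suc m)) ⟩
    sqrtSeries (suc (suc m)) + c₂ * sqrtSeries m + (- + 4) * (F ⊛ sqrtSeries) (suc m)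
      ≡⟨ cong (λ z → sqrtSeries (suc (suc m)) + c₂ * sqrtSeries m + (- + 4) * z)
              (trans (⊛-comm F sqrtSeries (suc m)) (sqrtSeries-⊛ F (suc m))) ⟩
    sqrtSeries (suc (suc m)) + c₂ * sqrtSeries m + (- + 4) * (F (suc m) + c₂ * shift F m + (- + 4) * (F ⊛ F) m)
      ≡⟨ cong (λ F₁ → 0ℤ + c₂ * one m + (- + 4) * F₁ + c₂ * sqrtSeries m
                      + (- + 4) * (F₁ + c₂ * shift F m + (- + 4) * (F ⊛ F) m))
              (F-quadratic m) ⟩
    0ℤ + c₂ * one m + (- + 4) * F₁ + c₂ * sqrtSeries m
    + (- + 4) * (F₁ + c₂ * shift F m + (- + 4) * (F ⊛ F) m)
      ≡⟨ cancel a (one m) (shift (shift one) m) (shift F m) ((F ⊛ F) m) ⟩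
    (- + 12 - + 4 * a) * one m + (+ 4 + + 4 * a * a - + 8 * a) * shift (shift one) m
      ≡⟨ sym (dilate-poly3 1ℤ (- + 12 - + 4 * a) (+ 4 + + 4 * a * a - + 8 * a) m) ⟩
    dilate (radicand a) (suc (suc m)) ∎
    where
    F₁ : ℤ
    F₁ = + 2 * (F ⊛ F) m + + 2 * (a - 1ℤ) * shift F m + + 2 * one m
    cancel : ∀ a d d₂ sF FF → let c = + 2 - + 2 * a ; F₁ = + 2 * FF + + 2 * (a - 1ℤ) * sF + + 2 * d in
      0ℤ + c * d + (- + 4) * F₁ + c * (d + c * d₂ + (- + 4) * sF) + (- + 4) * (F₁ + c * sF + (- + 4) * FF)
      ≡ (- + 12 - + 4 * a) * d + (+ 4 + + 4 * a * a - + 8 * a) * d₂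
    cancel = solve-∀

  T₀ D₁ : Series
  T₀ = pathSeries 0 nothing
  D₁ = pathSeries 1 nothing

  T₀≗dilate-T : T₀ ≗ dilate (T a x)
  T₀≗dilate-T n with even-or-odd n
  ... | inj₁ (m , refl) = begin
    sumWords (double m) (weight 0 nothing)
      ≡⟨ cong (λ k → sumWords k (weight 0 nothing)) (sym (2*≡double m)) ⟩
    sumWords (2 ℕ.* m) (weight 0 nothing) ≡⟨ sym (T≡sumWords-weight m) ⟩
    T a x m                                ≡⟨ sym (dilate-double (T a x) m) ⟩
    dilate (T a x) (double m)              ∎
  ... | inj₂ (m , refl) =
    trans (pathSeries-vanishes (suc (double m)) 0 nothing (sym (parity-double m)))
          (sym (dilate-odd (T a x) m))

  pathSeries₁-red≗nothing : pathSeries 1 (just red) ≗ D₁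
  pathSeries₁-red≗nothing zero    = refl
  pathSeries₁-red≗nothing (suc n) = trans (pathSeries₁-suc (just red) n) (sym (pathSeries₁-suc nothing n))

  T₀≗1+tD₁ : T₀ ≗ one ⊕ shift D₁
  T₀≗1+tD₁ zero    = refl
  T₀≗1+tD₁ (suc n) = trans (pathSeries₀-suc nothing n)
                           (trans (pathSeries₁-red≗nothing n) (sym (+-identityˡ (D₁ n))))

  D₁-suc : ∀ n → D₁ (suc n) ≡ x * (Fʳ ⊛ D₁) n + x * T₀ n
  D₁-suc n = trans (pathSeries₁-suc nothing n)
                   (cong₂ (λ u v → x * u + x * v) (pathSeries-factorises n 0 (just red)) (*-identityˡ (T₀ n)))

  -- numer and denom at u = t², divided by 4
  N D : Series
  N = one ⊕ ((- x) · shift Fʳ)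
  D = N ⊕ ((- x) · shift (shift one))

  T₀⊛D≗N : T₀ ⊛ D ≗ N
  T₀⊛D≗N n = trans (⊛-comm T₀ D n) (trans (D⊛T₀ n) (coefficient n))
    where
    D⊛T₀ : ∀ n → (D ⊛ T₀) n ≡ T₀ n + (- x) * shift (Fʳ ⊛ T₀) n + (- x) * shift (shift T₀) n
    D⊛T₀ n = begin
      (D ⊛ T₀) n
        ≡⟨ ⊛-distribʳ N ((- x) · shift (shift one)) T₀ n ⟩
      (N ⊛ T₀) n + (((- x) · shift (shift one)) ⊛ T₀) n
        ≡⟨ cong₂ _+_ (trans (⊛-distribʳ one ((- x) · shift Fʳ) T₀ n)
                        (cong₂ _+_ (⊛-identityˡ T₀ n)
                                   (trans (⊛-scaleˡ (- x) (shift Fʳ) T₀ n) (cong ((- x) *_) (⊛-shiftˡ Fʳ T₀ n)))))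
                     (trans (⊛-scaleˡ (- x) (shift (shift one)) T₀ n)
                            (cong ((- x) *_) (trans (⊛-shift²ˡ one T₀ n)
                                                    (shift-cong (shift-cong (⊛-identityˡ T₀)) n)))) ⟩
      T₀ n + (- x) * shift (Fʳ ⊛ T₀) n + (- x) * shift (shift T₀) n ∎
    Fʳ⊛T₀ : ∀ n → (Fʳ ⊛ T₀) n ≡ Fʳ n + shift (Fʳ ⊛ D₁) n
    Fʳ⊛T₀ n = trans (⊛-congʳ Fʳ T₀≗1+tD₁ n)
                    (trans (⊛-distribˡ Fʳ one (shift D₁) n) (cong₂ _+_ (⊛-identityʳ Fʳ n) (⊛-shiftʳ Fʳ D₁ n)))
    coefficient : ∀ n → T₀ n + (- x) * shift (Fʳ ⊛ T₀) n + (- x) * shift (shift T₀) n ≡ N n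
    coefficient zero          = constant x
      where
      constant : ∀ x → 1ℤ + (- x) * 0ℤ + (- x) * 0ℤ ≡ 1ℤ + (- x) * 0ℤ
      constant = solve-∀
    coefficient (suc zero)    = linear x
      where
      linear : ∀ x → 0ℤ + (- x) * (0ℤ * 1ℤ) + (- x) * 0ℤ ≡ 0ℤ + (- x) * 0ℤ
      linear = solve-∀
    coefficient (suc (suc m)) = begin
      T₀ (suc (suc m)) + (- x) * (Fʳ ⊛ T₀) (suc m) + (- x) * T₀ m
        ≡⟨ cong₂ (λ u v → u + (- x) * v + (- x) * T₀ m)
                 (trans (T₀≗1+tD₁ (suc (suc m))) (cong (_+_ 0ℤ) (D₁-suc m))) (Fʳ⊛T₀ (suc m)) ⟩
      0ℤ + (x * (Fʳ ⊛ D₁) m + x * T₀ m) + (- x) * (Fʳ (suc m) + (Fʳ ⊛ D₁) m) + (- x) * T₀ m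
        ≡⟨ cancel x ((Fʳ ⊛ D₁) m) (T₀ m) (Fʳ (suc m)) ⟩
      N (suc (suc m)) ∎
      where
      cancel : ∀ x A t F₁ → 0ℤ + (x * A + x * t) + (- x) * (F₁ + A) + (- x) * t ≡ 0ℤ + (- x) * F₁
      cancel = solve-∀

  module _ (S : Series) (dilate-S≗sqrtSeries : dilate S ≗ sqrtSeries) where

    S-constant-term : S 0 ≡ 1ℤ
    S-constant-term = trans (dilate-S≗sqrtSeries 0) sqrtSeries₀

    dilate-linear : ∀ c₀ c₁ m → dilate (poly3 c₀ c₁ 0ℤ ⊕ (x · S)) (suc (suc m)) ≡
                    c₁ * one m + x * sqrtSeries (suc (suc m))
    dilate-linear c₀ c₁ m = begin
      dilate (poly3 c₀ c₁ 0ℤ ⊕ (x · S)) (suc (suc m))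
        ≡⟨ dilate-⊕ (poly3 c₀ c₁ 0ℤ) (x · S) (suc (suc m)) ⟩
      dilate (poly3 c₀ c₁ 0ℤ) (suc (suc m)) + dilate (x · S) (suc (suc m))
        ≡⟨ cong₂ _+_ (dilate-poly3 c₀ c₁ 0ℤ m)
                     (trans (dilate-· x S (suc (suc m))) (cong (x *_) (dilate-S≗sqrtSeries (suc (suc m))))) ⟩
      c₁ * one m + 0ℤ * shift (shift one) m + x * sqrtSeries (suc (suc m))
        ≡⟨ cong (_+ x * sqrtSeries (suc (suc m))) (+-identityʳ (c₁ * one m)) ⟩
      c₁ * one m + x * sqrtSeries (suc (suc m)) ∎

    dilate-numer : dilate (numer a x S) ≗ (+ 4) · N
    dilate-numer zero          = trans (cong (λ s → + 4 - x + x * s) S-constant-term) (constant x)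
      where
      constant : ∀ x → + 4 - x + x * 1ℤ ≡ + 4 * (1ℤ + (- x) * 0ℤ)
      constant = solve-∀
    dilate-numer (suc zero)    = vanishes x
      where
      vanishes : ∀ x → 0ℤ ≡ + 4 * (0ℤ + (- x) * 0ℤ)
      vanishes = solve-∀
    dilate-numer (suc (suc m)) = begin
      dilate (numer a x S) (suc (suc m))
        ≡⟨ dilate-linear (+ 4 - x) (+ 2 * x - + 2 * x * a) m ⟩
      (+ 2 * x - + 2 * x * a) * one m + x * sqrtSeries (suc (suc m))
        ≡⟨ collect a x (one m) (F (suc m)) ⟩
      + 4 * (0ℤ + (- x) * (F (suc m) + (a - 1ℤ) * one m))
        ≡⟨ cong (λ z → + 4 * (0ℤ + (- x) * z)) (sym (Fʳ≗F+[a-1]t (suc m))) ⟩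
      + 4 * N (suc (suc m)) ∎
      where
      collect : ∀ a x d F₁ → (+ 2 * x - + 2 * x * a) * d + x * (0ℤ + (+ 2 - + 2 * a) * d + (- + 4) * F₁)
                           ≡ + 4 * (0ℤ + (- x) * (F₁ + (a - 1ℤ) * d))
      collect = solve-∀

    dilate-denom : dilate (denom a x S) ≗ (+ 4) · D
    dilate-denom zero          = trans (cong (λ s → + 4 - x + x * s) S-constant-term) (constant x)
      where
      constant : ∀ x → + 4 - x + x * 1ℤ ≡ + 4 * (1ℤ + (- x) * 0ℤ + (- x) * 0ℤ)
      constant = solve-∀
    dilate-denom (suc zero)    = vanishes x
      where
      vanishes : ∀ x → 0ℤ ≡ + 4 * (0ℤ + (- x) * 0ℤ + (- x) * 0ℤ)
      vanishes = solve-∀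
    dilate-denom (suc (suc m)) = begin
      dilate (denom a x S) (suc (suc m))
        ≡⟨ dilate-linear (+ 4 - x) (- (+ 2 * x) - + 2 * x * a) m ⟩
      (- (+ 2 * x) - + 2 * x * a) * one m + x * sqrtSeries (suc (suc m))
        ≡⟨ collect a x (one m) (F (suc m)) ⟩
      + 4 * (0ℤ + (- x) * (F (suc m) + (a - 1ℤ) * one m) + (- x) * one m)
        ≡⟨ cong (λ z → + 4 * (0ℤ + (- x) * z + (- x) * one m)) (sym (Fʳ≗F+[a-1]t (suc m))) ⟩
      + 4 * D (suc (suc m)) ∎
      where
      collect : ∀ a x d F₁ → (- (+ 2 * x) - + 2 * x * a) * d + x * (0ℤ + (+ 2 - + 2 * a) * d + (- + 4) * F₁)
                           ≡ + 4 * (0ℤ + (- x) * (F₁ + (a - 1ℤ) * d) + (- x) * d)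
      collect = solve-∀

mainTheorem8 : (a x : ℤ) (S : Series) →
    S 0 ≡ 1ℤ → (∀ n → (S ⊛ S) n ≡ radicand a n) →
    ∀ n → (T a x ⊛ denom a x S) n ≡ numer a x S n
mainTheorem8 a x S S₀≡1 S²≡radicand n = begin
  (T a x ⊛ denom a x S) n
    ≡⟨ sym (dilate-double (T a x ⊛ denom a x S) n) ⟩
  dilate (T a x ⊛ denom a x S) (double n)
    ≡⟨ sym (dilate-⊛ (T a x) (denom a x S) (double n)) ⟩
  (dilate (T a x) ⊛ dilate (denom a x S)) (double n)
    ≡⟨ ⊛-cong (sym ∘ T₀≗dilate-T) (dilate-denom S dilate-S≗sqrtSeries) (double n) ⟩
  (T₀ ⊛ ((+ 4) · D)) (double n)
    ≡⟨ ⊛-scaleʳ (+ 4) T₀ D (double n) ⟩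
  + 4 * (T₀ ⊛ D) (double n)
    ≡⟨ cong (+ 4 *_) (T₀⊛D≗N (double n)) ⟩
  + 4 * N (double n)
    ≡⟨ sym (dilate-numer S dilate-S≗sqrtSeries (double n)) ⟩
  dilate (numer a x S) (double n)
    ≡⟨ dilate-double (numer a x S) n ⟩
  numer a x S n ∎
  where
  open ≡-Reasoning
  open WeightedPaths a x
  dilate-S≗sqrtSeries : dilate S ≗ sqrtSeries
  dilate-S≗sqrtSeries = sqrt-unique (dilate S) sqrtSeries
    (λ k → trans (dilate-⊛ S S k) (trans (dilate-cong S²≡radicand k) (sym (sqrtSeries-squared k))))
    S₀≡1 sqrtSeries₀
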